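{- Let $x\le y$ in $\mathcal{P}(n;\epsilon)$ and let $\mathcal{E}^{\times}(y\backslash x)=\{(j,k)\notin\mathcal{E}(x): (i,k),(j,l)\in\mathcal{E}(y)\text{ for some } i<j<k<l\}$. Then the Möbius function of $\mathcal{P}(n;\epsilon)$ satisfies $\mu(x,y)=0$ if $\mathcal{E}^{\times}(y\backslash x)\neq\emptyset$, and $\mu(x,y)=(-1)^{\rho(y)-\rho(x)}$ otherwise.
   Context: A network on $n$ points is a set $E$ of pairs $(i,j)$ with $1\le i<j\le n$ (directed edges; $i$ a source, $j$ a sink) with no $(i,j),(j,k)\in E$, satisfying (B1): if $(i,k),(j,l)\in E$ with $i<j<k<l$ then $(j,k)\in E$. Let $\epsilon\in\{1,0,-1\}^n$ have first nonzero entry (if any) equal to $1$; $\mathcal{N}(n;\epsilon)$ is the set of such networks in which every source $i$ has $\epsilon_i=1$ and every sink $j$ has $\epsilon_j=-1$. $\mathcal{E}(x)$ is the edge set of $x$, $\rho(x)=|\mathcal{E}(x)|$; $x\lessdot y$ iff $\rho(y)=\rho(x)+1$ and $\mathcal{E}(x)\subset\mathcal{E}(y)$; $x\le y$ iff there is a chain of covers from $x$ to $y$; $\mathcal{P}(n;\epsilon)=(\mathcal{N}(n;\epsilon),\le)$. The Möbius function is defined by $\mu(x,x)=1$ and $\mu(x,y)=-\sum_{x\le z<y}\mu(x,z)$ for $x<y$. -}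

module Defs where

open import Data.Bool using (Bool; true; false; _∧_; _∨_; not; if_then_else_; T; T?)
open import Data.Bool.ListAction using (all; any)
import Data.Bool as B
open import Data.Nat using (ℕ; zero; suc; _∸_; _<ᵇ_; _<_)
import Data.Nat as N
open import Data.Fin using (Fin; toℕ)
open import Data.List using (List; []; _∷_; map; concatMap; foldr; filter; allFin)
open import Data.Vec using (Vec; []; _∷_; lookup)
open import Data.Vec.Properties using (≡-dec)
open import Data.Integer using (ℤ; -_; _+_; 0ℤ; 1ℤ)
open import Data.Product using (∃; _×_; _,_)
open import Relation.Binary.PropositionalEquality using (_≡_; _≢_)
open import Relation.Nullary.Decidable using (⌊_⌋)
open import Relation.Binary.Construct.Closure.ReflexiveTransitive using (Star)

-- Points 1..n are represented by Fin n (0-based, same order).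

data Sign : Set where
  plus zer minus : Sign

FirstNonzeroPlus : {n : ℕ} → (Fin n → Sign) → Set
FirstNonzeroPlus {n} ε =
  (i : Fin n) → ε i ≢ zer → ((j : Fin n) → toℕ j < toℕ i → ε j ≡ zer) → ε i ≡ plus

isPlus isMinus : Sign → Bool
isPlus plus = true
isPlus _    = false
isMinus minus = true
isMinus _     = false

-- An edge set on n points: a Boolean n×n matrix; (i,j) ∈ E iff entry (i,j) is true.
EdgeSet : ℕ → Set
EdgeSet n = Vec (Vec Bool n) n

edge : {n : ℕ} → EdgeSet n → Fin n → Fin n → Bool
edge E i j = lookup (lookup E i) j

_<F_ : {n : ℕ} → Fin n → Fin n → Bool
i <F j = toℕ i <ᵇ toℕ j

∀F : {n : ℕ} → (Fin n → Bool) → Bool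
∀F {n} p = all p (allFin n)

∃F : {n : ℕ} → (Fin n → Bool) → Bool
∃F {n} p = any p (allFin n)

_⇒_ : Bool → Bool → Bool
a ⇒ b = not a ∨ b

-- E is a network in N(n;ε):
--  * every edge (i,j) has i < j,
--  * no (i,j),(j,k) ∈ E,
--  * (B1): (i,k),(j,l) ∈ E with i<j<k<l implies (j,k) ∈ E,
--  * every source i has ε_i = 1 and every sink j has ε_j = -1.
isNetwork : {n : ℕ} → (Fin n → Sign) → EdgeSet n → Bool
isNetwork ε E =
  ∀F (λ i → ∀F (λ j → edge E i j ⇒ ((i <F j) ∧ isPlus (ε i) ∧ isMinus (ε j))))
  ∧ ∀F (λ i → ∀F (λ j → ∀F (λ k → not (edge E i j ∧ edge E j k))))
  ∧ ∀F (λ i → ∀F (λ j → ∀F (λ k → ∀F (λ l →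
      ((i <F j) ∧ (j <F k) ∧ (k <F l) ∧ edge E i k ∧ edge E j l) ⇒ edge E j k))))

Network : {n : ℕ} → (Fin n → Sign) → EdgeSet n → Set
Network ε E = T (isNetwork ε E)

countB : List Bool → ℕ
countB = foldr (λ b r → if b then suc r else r) 0

ρ : {n : ℕ} → EdgeSet n → ℕ
ρ {n} E = foldr N._+_ 0 (map (λ i → countB (map (λ j → edge E i j) (allFin n))) (allFin n))

subsetB : {n : ℕ} → EdgeSet n → EdgeSet n → Bool
subsetB x y = ∀F (λ i → ∀F (λ j → edge x i j ⇒ edge y i j))

_==_ : {n : ℕ} → EdgeSet n → EdgeSet n → Bool
x == y = ⌊ ≡-dec (≡-dec B._≟_) x y ⌋

coverB : {n : ℕ} → (Fin n → Sign) → EdgeSet n → EdgeSet n → Bool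
coverB ε x y = isNetwork ε x ∧ isNetwork ε y ∧ (ρ y N.≡ᵇ suc (ρ x)) ∧ subsetB x y

Cover : {n : ℕ} → (Fin n → Sign) → EdgeSet n → EdgeSet n → Set
Cover ε x y = T (coverB ε x y)

_≤[_]_ : {n : ℕ} → EdgeSet n → (Fin n → Sign) → EdgeSet n → Set
x ≤[ ε ] y = Star (Cover ε) x y

allVec : {A : Set} → List A → (k : ℕ) → List (Vec A k)
allVec xs zero    = [] ∷ []
allVec xs (suc k) = concatMap (λ a → map (a ∷_) (allVec xs k)) xs

allEdgeSets : (n : ℕ) → List (EdgeSet n)
allEdgeSets n = allVec (allVec (true ∷ false ∷ []) n) n

-- Since every cover raises ρ by one,
-- x ≤ y iff chainB (ρ y ∸ ρ x) x y (and x is a network).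
chainB : {n : ℕ} → (Fin n → Sign) → ℕ → EdgeSet n → EdgeSet n → Bool
chainB {n} ε zero    x y = isNetwork ε x ∧ (x == y)
chainB {n} ε (suc k) x y = any (λ z → coverB ε x z ∧ chainB ε k z y) (allEdgeSets n)

leqB : {n : ℕ} → (Fin n → Sign) → EdgeSet n → EdgeSet n → Bool
leqB ε x y = chainB ε (ρ y ∸ ρ x) x y

sumℤ : List ℤ → ℤ
sumℤ = foldr _+_ 0ℤ

-- Möbius function: μ(x,x) = 1, μ(x,y) = - Σ_{x ≤ z < y} μ(x,z) for x < y.
-- The first argument is fuel (recursion on ρ); it is chosen large enough below.
μF : {n : ℕ} → (Fin n → Sign) → ℕ → EdgeSet n → EdgeSet n → ℤ
μF ε zero    x y = 0ℤ
μF {n} ε (suc k) x y =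
  if x == y then 1ℤ
  else - sumℤ (map (μF ε k x)
                 (filter (λ z → T? (leqB ε x z ∧ leqB ε z y ∧ not (z == y)))
                         (allEdgeSets n)))

μ : {n : ℕ} → (Fin n → Sign) → EdgeSet n → EdgeSet n → ℤ
μ ε x y = μF ε (suc (ρ y ∸ ρ x)) x y

CrossingNonempty : {n : ℕ} → EdgeSet n → EdgeSet n → Set
CrossingNonempty {n} x y =
  ∃ λ (i : Fin n) → ∃ λ (j : Fin n) → ∃ λ (k : Fin n) → ∃ λ (l : Fin n) →
    toℕ i < toℕ j × toℕ j < toℕ k × toℕ k < toℕ l ×
    T (edge y i k) × T (edge y j l) × T (not (edge x j k))

{-# OPTIONS --safe #-}
-- Let μ̃(x, w) be (-1)^(ρ w - ρ x) if E^×(w \ x) = ∅ and 0 otherwise.  μ = μ̃ follows by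
-- induction along the recursion defining μ once Σ_{x ≤ w ≤ z} μ̃(x, w) = 0 for x < z.  In that
-- range μ̃(x, w) ≠ 0 exactly for the admissible w: x ⊆ w ⊆ z with E^×(w \ x) = ∅.  Conversely
-- every admissible w satisfies (B1), hence is a network, and lies in [x, z] because networks
-- x ⊆ z are always joined by a chain of covers.  Both the cancellation and the chains come from
-- a free edge (a, b) of z over x: an edge of z \ x all of whose crossings with edges of z have
-- their middle edge in x.  Toggling (a, b) preserves admissibility and flips the sign, so the
-- admissible w cancel in pairs; and adding (a, b) to x is a cover.  A free edge exists: if a
-- crossing in z of (a, b) ∈ z \ x has its middle edge outside x, that middle edge is in z by
-- (B1), not in x, and strictly shorter than (a, b).
module Submission where

open import Defs
open import Algebra.Bundles using (AbelianGroup)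
open import Data.Bool using (Bool; true; false; _∧_; not; if_then_else_; T)
import Data.Bool as Bool
open import Data.Bool.Properties using (T-∧; ∧-zeroʳ; not-involutive)
open import Data.Empty using (⊥-elim)
open import Data.Fin using (Fin; toℕ) renaming (zero to fzero; suc to fsuc)
import Data.Fin.Properties as Fin
open import Data.Integer using (ℤ; _+_; -_; 0ℤ; 1ℤ; _^_)
import Data.Integer.Properties as ℤ
open import Data.List using (List; []; _∷_; map; filter; concatMap; _++_; tabulate; allFin)
open import Data.List.Membership.Propositional using (_∈_; lose)
open import Data.List.Membership.Propositional.Properties using (∈-allFin; ∈-map⁺; ∈-concatMap⁺)
open import Data.List.Properties using (map-tabulate; tabulate-cong)
import Data.List.Relation.Unary.All as All
open import Data.List.Relation.Unary.All.Properties using (all⁺; all⁻)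
open import Data.List.Relation.Unary.Any using (here; there; satisfied)
open import Data.List.Relation.Unary.Any.Properties using (any⁺; any⁻)
open import Data.Nat using (ℕ; zero; suc; _∸_; _<_; _≤_; z≤n; s≤s) renaming (_+_ to _+ℕ_)
open import Data.Nat.Induction using (<-wellFounded)
open import Data.Nat.ListAction using (sum)
import Data.Nat.Properties as ℕ
open import Data.Product using (_×_; _,_; proj₁)
open import Data.Sum using (_⊎_; inj₁; inj₂)
open import Data.Vec using (Vec; []; _∷_; lookup; updateAt)
import Data.Vec.Properties as Vec
open import Function using (_∘_; _⇔_; mk⇔; Equivalence; case_of_)
open import Induction.WellFounded using (Acc; acc)
open import Relation.Binary.Construct.Closure.ReflexiveTransitive using (_◅_) renaming (ε to ε★)
open import Relation.Binary.Definitions using (DecidableEquality)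
open import Relation.Binary.PropositionalEquality
open import Relation.Nullary using (¬_; Dec; does; yes; no; ¬?; _×-dec_; _→-dec_)
open import Relation.Nullary.Decidable
  using (T?; map′; isYes; decidable-stable; dec-true; dec-false; isYes≗does; toWitness; fromWitness; toWitnessFalse; fromWitnessFalse)

open import Algebra.Properties.CommutativeSemigroup ℤ.+-commutativeSemigroup using (interchange)
open import Algebra.Properties.Group (AbelianGroup.group ℤ.+-0-abelianGroup) using (inverseˡ-unique)
open Equivalence using (to; from)
open ≡-Reasoning

T-does : ∀ {A : Set} (a? : Dec A) → T (does a?) ⇔ A
T-does (yes a) = mk⇔ (λ _ → a) _
T-does (no ¬a) = mk⇔ (λ ()) ¬a

T-not : ∀ {b} → T (not b) ⇔ (¬ T b)
T-not {b} = T-does (¬? (T? b))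

T-∀F : ∀ {n} {p : Fin n → Bool} → T (∀F p) ⇔ (∀ i → T (p i))
T-∀F {n} {p} = mk⇔ (λ h i → All.lookup (all⁺ p (allFin n) h) (∈-allFin i))
                   (λ h → all⁻ p {allFin n} (All.tabulate (λ {i} _ → h i)))

∀F? : ∀ {n} {P : Fin n → Set} → (∀ i → Dec (P i)) → Dec (∀ i → P i)
∀F? P? = map′ (λ h i → to (T-does (P? i)) (to T-∀F h i))
              (λ h → from T-∀F (λ i → from (T-does (P? i)) (h i)))
              (T? (∀F (λ i → does (P? i))))

module _ {n : ℕ} where

  _⊆_ : EdgeSet n → EdgeSet n → Set
  x ⊆ y = ∀ i j → T (edge x i j) → T (edge y i j)

  Crossing : EdgeSet n → Fin n → Fin n → Fin n → Fin n → Set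
  Crossing w i j k l =
    toℕ i < toℕ j × toℕ j < toℕ k × toℕ k < toℕ l × T (edge w i k) × T (edge w j l)

  NoNewCrossing : EdgeSet n → EdgeSet n → Set
  NoNewCrossing x w = ∀ i j k l → Crossing w i j k l → T (edge x j k)

  B1 : EdgeSet n → Set
  B1 w = NoNewCrossing w w

  record IsNetwork (ε : Fin n → Sign) (E : EdgeSet n) : Set where
    constructor network
    field
      signed    : ∀ i j → T (edge E i j) → toℕ i < toℕ j × T (isPlus (ε i)) × T (isMinus (ε j))
      path-free : ∀ i j k → ¬ (T (edge E i j) × T (edge E j k))
      b1        : B1 E

  record IsCover (ε : Fin n → Sign) (x y : EdgeSet n) : Set where
    constructor cover
    field
      source : IsNetwork ε x
      target : IsNetwork ε y
      ρ-suc  : ρ y ≡ suc (ρ x)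
      subset : x ⊆ y

  -- Each decision procedure below computes, definitionally, the Boolean that Defs uses for
  -- the same property, so T-does converts between the two.

  _⊆?_ : ∀ x y → Dec (x ⊆ y)
  x ⊆? y = ∀F? λ i → ∀F? λ j → T? (edge x i j) →-dec T? (edge y i j)

  crossing? : ∀ w i j k l → Dec (Crossing w i j k l)
  crossing? w i j k l = toℕ i ℕ.<? toℕ j ×-dec toℕ j ℕ.<? toℕ k ×-dec toℕ k ℕ.<? toℕ l
                        ×-dec T? (edge w i k) ×-dec T? (edge w j l)

  noNewCrossing? : ∀ x w → Dec (NoNewCrossing x w)
  noNewCrossing? x w = ∀F? λ i → ∀F? λ j → ∀F? λ k → ∀F? λ l →
    crossing? w i j k l →-dec T? (edge x j k)

  isNetwork? : ∀ ε E → Dec (IsNetwork ε E)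
  isNetwork? ε E = map′ (λ (s , p , b) → network s p b) (λ (network s p b) → s , p , b)
    ((∀F? λ i → ∀F? λ j → T? (edge E i j) →-dec
        (toℕ i ℕ.<? toℕ j ×-dec T? (isPlus (ε i)) ×-dec T? (isMinus (ε j))))
     ×-dec (∀F? λ i → ∀F? λ j → ∀F? λ k → ¬? (T? (edge E i j) ×-dec T? (edge E j k)))
     ×-dec noNewCrossing? E E)

  isCover? : ∀ ε x y → Dec (IsCover ε x y)
  isCover? ε x y = map′ (λ (s , t , r , u) → cover s t r u) (λ (cover s t r u) → s , t , r , u)
    (isNetwork? ε x ×-dec isNetwork? ε y ×-dec ρ y ℕ.≟ suc (ρ x) ×-dec x ⊆? y)

  network⁻ : ∀ ε E → Network ε E → IsNetwork ε E
  network⁻ ε E = to (T-does (isNetwork? ε E))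

  network⁺ : ∀ ε E → IsNetwork ε E → Network ε E
  network⁺ ε E = from (T-does (isNetwork? ε E))

  cover⁻ : ∀ ε x y → Cover ε x y → IsCover ε x y
  cover⁻ ε x y = to (T-does (isCover? ε x y))

  cover⁺ : ∀ ε x y → IsCover ε x y → Cover ε x y
  cover⁺ ε x y = from (T-does (isCover? ε x y))

  _≟ₑ_ : DecidableEquality (EdgeSet n)
  _≟ₑ_ = Vec.≡-dec (Vec.≡-dec Bool._≟_)

  ==-true : ∀ {w z} → w ≡ z → (w == z) ≡ true
  ==-true {w} {z} w≡z = trans (isYes≗does (w ≟ₑ z)) (dec-true (w ≟ₑ z) w≡z)

  ==-false : ∀ {w z} → w ≢ z → (w == z) ≡ false
  ==-false {w} {z} w≢z = trans (isYes≗does (w ≟ₑ z)) (dec-false (w ≟ₑ z) w≢z)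

  crossingNonempty⇒¬noNewCrossing : ∀ x y → CrossingNonempty x y → ¬ NoNewCrossing x y
  crossingNonempty⇒¬noNewCrossing x y (i , j , k , l , i<j , j<k , k<l , ik , jl , jk∉x) nc =
    to T-not jk∉x (nc i j k l (i<j , j<k , k<l , ik , jl))

  ¬crossingNonempty⇒noNewCrossing : ∀ x y → ¬ CrossingNonempty x y → NoNewCrossing x y
  ¬crossingNonempty⇒noNewCrossing x y none i j k l (i<j , j<k , k<l , ik , jl) =
    decidable-stable (T? _) (λ jk∉x → none (i , j , k , l , i<j , j<k , k<l , ik , jl , from T-not jk∉x))

module _ {n : ℕ} where

  ⊆-refl : {x : EdgeSet n} → x ⊆ x
  ⊆-refl i j e = e

  ⊆-trans : {x y z : EdgeSet n} → x ⊆ y → y ⊆ z → x ⊆ z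
  ⊆-trans x⊆y y⊆z i j e = y⊆z i j (x⊆y i j e)

  ⊆-antisym : {x y : EdgeSet n} → x ⊆ y → y ⊆ x → x ≡ y
  ⊆-antisym {x} {y} x⊆y y⊆x = matrix-ext (λ i j → T-ext (x⊆y i j) (y⊆x i j))
    where
    T-ext : ∀ {a b} → (T a → T b) → (T b → T a) → a ≡ b
    T-ext {false} {false} _ _ = refl
    T-ext {false} {true}  _ g = ⊥-elim (g _)
    T-ext {true}  {false} f _ = ⊥-elim (f _)
    T-ext {true}  {true}  _ _ = refl
    vec-ext : ∀ {A : Set} {u v : Vec A n} → (∀ j → lookup u j ≡ lookup v j) → u ≡ v
    vec-ext {u = u} {v} h =
      trans (sym (Vec.tabulate∘lookup u)) (trans (Vec.tabulate-cong h) (Vec.tabulate∘lookup v))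
    matrix-ext : (∀ i j → edge x i j ≡ edge y i j) → x ≡ y
    matrix-ext h = vec-ext (λ i → vec-ext (h i))

  crossing-⊆ : ∀ {w w′ : EdgeSet n} {i j k l} → w ⊆ w′ → Crossing w i j k l → Crossing w′ i j k l
  crossing-⊆ w⊆w′ (i<j , j<k , k<l , ik , jl) = i<j , j<k , k<l , w⊆w′ _ _ ik , w⊆w′ _ _ jl

  noNewCrossing-⊆ : ∀ {x w w′ : EdgeSet n} → w ⊆ w′ → NoNewCrossing x w′ → NoNewCrossing x w
  noNewCrossing-⊆ {w = w} {w′} w⊆w′ nc i j k l cr = nc i j k l (crossing-⊆ {w} {w′} w⊆w′ cr)

  noNewCrossing⇒B1 : ∀ {x w : EdgeSet n} → x ⊆ w → NoNewCrossing x w → B1 w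
  noNewCrossing⇒B1 x⊆w nc i j k l cr = x⊆w j k (nc i j k l cr)

  network-⊆ : ∀ {ε} {w z : EdgeSet n} → IsNetwork ε z → w ⊆ z → B1 w → IsNetwork ε w
  network-⊆ (network signed path-free _) w⊆z b1 = network
    (λ i j e → signed i j (w⊆z i j e))
    (λ i j k (ij , jk) → path-free i j k (w⊆z i j ij , w⊆z j k jk))
    b1

-- Toggling one edge

module _ {n : ℕ} where

  toggle : EdgeSet n → Fin n → Fin n → EdgeSet n
  toggle E a b = updateAt E a (λ r → updateAt r b not)

  edge-toggle-same : ∀ E a b → edge (toggle E a b) a b ≡ not (edge E a b)
  edge-toggle-same E a b = begin
    lookup (lookup (toggle E a b) a) b     ≡⟨ cong (λ r → lookup r b) (Vec.lookup∘updateAt a E) ⟩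
    lookup (updateAt (lookup E a) b not) b ≡⟨ Vec.lookup∘updateAt b (lookup E a) ⟩
    not (edge E a b)                       ∎

  edge-toggle-other : ∀ E {a b i j} → ¬ (i ≡ a × j ≡ b) → edge (toggle E a b) i j ≡ edge E i j
  edge-toggle-other E {a} {b} {i} {j} ij≢ab with i Fin.≟ a
  ... | no i≢a   = cong (λ r → lookup r j) (Vec.lookup∘updateAt′ i a i≢a E)
  ... | yes refl = trans (cong (λ r → lookup r j) (Vec.lookup∘updateAt a E))
                         (Vec.lookup∘updateAt′ j b (λ j≡b → ij≢ab (refl , j≡b)) (lookup E a))

  toggle-involutive : ∀ E a b → toggle (toggle E a b) a b ≡ E
  toggle-involutive E a b = begin
    toggle (toggle E a b) a b  ≡⟨ Vec.updateAt-updateAt a E ⟩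
    updateAt E a (flip ∘ flip) ≡⟨ Vec.updateAt-cong a flip-involutive E ⟩
    updateAt E a (λ r → r)     ≡⟨ Vec.updateAt-id a E ⟩
    E                          ∎
    where
    flip : Vec Bool n → Vec Bool n
    flip r = updateAt r b not
    flip-involutive : ∀ r → flip (flip r) ≡ r
    flip-involutive r = trans (Vec.updateAt-updateAt b r)
      (trans (Vec.updateAt-cong b not-involutive r) (Vec.updateAt-id b r))

  edge-toggle⁻ : ∀ (w : EdgeSet n) {a b i j} → T (edge (toggle w a b) i j) → (i ≡ a × j ≡ b) ⊎ T (edge w i j)
  edge-toggle⁻ w {a} {b} {i} {j} e with i Fin.≟ a ×-dec j Fin.≟ b
  ... | yes ij≡ab = inj₁ ij≡ab
  ... | no ij≢ab  = inj₂ (subst T (edge-toggle-other w ij≢ab) e)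

  toggle-removes : ∀ (w : EdgeSet n) {a b} → T (edge w a b) → ¬ T (edge (toggle w a b) a b)
  toggle-removes w {a} {b} ab∈w ab∈w′ = to T-not (subst T (edge-toggle-same w a b) ab∈w′) ab∈w

  ⊆-toggle : ∀ (w : EdgeSet n) {a b} → ¬ T (edge w a b) → w ⊆ toggle w a b
  ⊆-toggle w ab∉w i j e = subst T (sym (edge-toggle-other w λ { (refl , refl) → ab∉w e })) e

-- Counting edges

-- Unlike ρ, edgeCount unfolds row by row, so it can be reasoned about by induction on the matrix.
rowCount : ∀ {k} → Vec Bool k → ℕ
rowCount r = countB (tabulate (lookup r))

edgeCount : ∀ {m k} → Vec (Vec Bool k) m → ℕ
edgeCount E = sum (tabulate (λ i → rowCount (lookup E i)))

ρ≡edgeCount : ∀ {n} (E : EdgeSet n) → ρ E ≡ edgeCount E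
ρ≡edgeCount {n} E = cong sum (trans (map-tabulate {n = n} (λ i → i) row)
  (tabulate-cong (λ i → cong countB (map-tabulate {n = n} (λ j → j) (edge E i)))))
  where row = λ i → countB (map (edge E i) (allFin n))

rowCount-mono : ∀ {k} (r s : Vec Bool k) → (∀ j → T (lookup r j) → T (lookup s j)) → rowCount r ≤ rowCount s
rowCount-mono []          []          _ = z≤n
rowCount-mono (true ∷ r)  (true ∷ s)  h = s≤s (rowCount-mono r s (h ∘ fsuc))
rowCount-mono (true ∷ r)  (false ∷ s) h = ⊥-elim (h fzero _)
rowCount-mono (false ∷ r) (true ∷ s)  h = ℕ.m≤n⇒m≤1+n (rowCount-mono r s (h ∘ fsuc))
rowCount-mono (false ∷ r) (false ∷ s) h = rowCount-mono r s (h ∘ fsuc)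

edgeCount-mono : ∀ {m k} (E F : Vec (Vec Bool k) m) →
  (∀ i j → T (lookup (lookup E i) j) → T (lookup (lookup F i) j)) → edgeCount E ≤ edgeCount F
edgeCount-mono []      []      _ = z≤n
edgeCount-mono (r ∷ E) (s ∷ F) h = ℕ.+-mono-≤ (rowCount-mono r s (h fzero)) (edgeCount-mono E F (h ∘ fsuc))

rowCount-set : ∀ {k} (r : Vec Bool k) b → ¬ T (lookup r b) → rowCount (updateAt r b not) ≡ suc (rowCount r)
rowCount-set (true ∷ r)  fzero    b∉r = ⊥-elim (b∉r _)
rowCount-set (false ∷ r) fzero    _   = refl
rowCount-set (true ∷ r)  (fsuc b) b∉r = cong suc (rowCount-set r b b∉r)
rowCount-set (false ∷ r) (fsuc b) b∉r = rowCount-set r b b∉r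

edgeCount-updateAt : ∀ {m k} (E : Vec (Vec Bool k) m) a (f : Vec Bool k → Vec Bool k) →
  rowCount (f (lookup E a)) ≡ suc (rowCount (lookup E a)) → edgeCount (updateAt E a f) ≡ suc (edgeCount E)
edgeCount-updateAt (r ∷ E) fzero    f e = cong (_+ℕ edgeCount E) e
edgeCount-updateAt (r ∷ E) (fsuc a) f e =
  trans (cong (rowCount r +ℕ_) (edgeCount-updateAt E a f e)) (ℕ.+-suc (rowCount r) (edgeCount E))

module _ {n : ℕ} where

  ρ-mono : ∀ (x y : EdgeSet n) → x ⊆ y → ρ x ≤ ρ y
  ρ-mono x y x⊆y = subst₂ _≤_ (sym (ρ≡edgeCount x)) (sym (ρ≡edgeCount y)) (edgeCount-mono x y x⊆y)

  ρ-toggle : ∀ (E : EdgeSet n) a b → ¬ T (edge E a b) → ρ (toggle E a b) ≡ suc (ρ E)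
  ρ-toggle E a b ab∉E = begin
    ρ (toggle E a b)         ≡⟨ ρ≡edgeCount (toggle E a b) ⟩
    edgeCount (toggle E a b) ≡⟨ edgeCount-updateAt E a _ (rowCount-set (lookup E a) b ab∉E) ⟩
    suc (edgeCount E)        ≡⟨ cong suc (ρ≡edgeCount E) ⟨
    suc (ρ E)                ∎

-- Sums over finite enumerations

module _ {A : Set} where

  ∑ : List A → (A → ℤ) → ℤ
  ∑ xs f = sumℤ (map f xs)

  ∑-cong : ∀ xs {f g : A → ℤ} → (∀ x → f x ≡ g x) → ∑ xs f ≡ ∑ xs g
  ∑-cong []       _   = refl
  ∑-cong (x ∷ xs) f≗g = cong₂ _+_ (f≗g x) (∑-cong xs f≗g)

  ∑-zero : ∀ xs → ∑ xs (λ _ → 0ℤ) ≡ 0ℤ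
  ∑-zero []       = refl
  ∑-zero (x ∷ xs) = trans (ℤ.+-identityˡ _) (∑-zero xs)

  ∑-neg : ∀ xs (f : A → ℤ) → ∑ xs (λ x → - f x) ≡ - ∑ xs f
  ∑-neg []       f = refl
  ∑-neg (x ∷ xs) f = trans (cong (- f x +_) (∑-neg xs f)) (sym (ℤ.neg-distrib-+ (f x) (∑ xs f)))

  ∑-+ : ∀ xs (f g : A → ℤ) → ∑ xs (λ x → f x + g x) ≡ ∑ xs f + ∑ xs g
  ∑-+ []       f g = refl
  ∑-+ (x ∷ xs) f g = trans (cong (f x + g x +_) (∑-+ xs f g)) (interchange (f x) (g x) _ _)

  ∑-++ : ∀ xs ys (f : A → ℤ) → ∑ (xs ++ ys) f ≡ ∑ xs f + ∑ ys f
  ∑-++ []       ys f = sym (ℤ.+-identityˡ (∑ ys f))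
  ∑-++ (x ∷ xs) ys f = trans (cong (f x +_) (∑-++ xs ys f)) (sym (ℤ.+-assoc (f x) _ _))

  ∑-filter : ∀ xs (p : A → Bool) (f : A → ℤ) →
    ∑ (filter (λ x → T? (p x)) xs) f ≡ ∑ xs (λ x → if p x then f x else 0ℤ)
  ∑-filter []       p f = refl
  ∑-filter (x ∷ xs) p f with p x
  ... | true  = cong (f x +_) (∑-filter xs p f)
  ... | false = trans (∑-filter xs p f) (sym (ℤ.+-identityˡ _))

module _ {A B : Set} where

  ∑-map : ∀ xs (g : A → B) (f : B → ℤ) → ∑ (map g xs) f ≡ ∑ xs (f ∘ g)
  ∑-map []       g f = refl
  ∑-map (x ∷ xs) g f = cong (f (g x) +_) (∑-map xs g f)

  ∑-concatMap : ∀ xs (g : A → List B) (f : B → ℤ) → ∑ (concatMap g xs) f ≡ ∑ xs (λ a → ∑ (g a) f)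
  ∑-concatMap []       g f = refl
  ∑-concatMap (x ∷ xs) g f =
    trans (∑-++ (g x) (concatMap g xs) f) (cong (∑ (g x) f +_) (∑-concatMap xs g f))

module _ {A : Set} (xs : List A) where

  ∈-allVec : (∀ a → a ∈ xs) → ∀ {k} (v : Vec A k) → v ∈ allVec xs k
  ∈-allVec complete []            = here refl
  ∈-allVec complete {suc k} (a ∷ v) = ∈-concatMap⁺ (λ b → map (b ∷_) (allVec xs k))
    (lose (complete a) (∈-map⁺ (a ∷_) (∈-allVec complete v)))

  ∑-allVec-suc : ∀ k (h : Vec A (suc k) → ℤ) →
    ∑ (allVec xs (suc k)) h ≡ ∑ xs (λ a → ∑ (allVec xs k) (h ∘ (a ∷_)))
  ∑-allVec-suc k h = trans (∑-concatMap xs (λ a → map (a ∷_) (allVec xs k)) h)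
    (∑-cong xs (λ a → ∑-map (allVec xs k) (a ∷_) h))

  ∑-allVec-updateAt : (τ : A → A) → (∀ g → ∑ xs (g ∘ τ) ≡ ∑ xs g) →
    ∀ k i (h : Vec A k → ℤ) → ∑ (allVec xs k) (λ v → h (updateAt v i τ)) ≡ ∑ (allVec xs k) h
  ∑-allVec-updateAt τ τ-invariant (suc k) fzero h = begin
    ∑ (allVec xs (suc k)) (λ v → h (updateAt v fzero τ)) ≡⟨ ∑-allVec-suc k _ ⟩
    ∑ xs (λ a → ∑ (allVec xs k) (h ∘ (τ a ∷_)))          ≡⟨ τ-invariant (λ a → ∑ (allVec xs k) (h ∘ (a ∷_))) ⟩
    ∑ xs (λ a → ∑ (allVec xs k) (h ∘ (a ∷_)))            ≡⟨ ∑-allVec-suc k h ⟨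
    ∑ (allVec xs (suc k)) h                               ∎
  ∑-allVec-updateAt τ τ-invariant (suc k) (fsuc i) h = begin
    ∑ (allVec xs (suc k)) (λ v → h (updateAt v (fsuc i) τ))     ≡⟨ ∑-allVec-suc k _ ⟩
    ∑ xs (λ a → ∑ (allVec xs k) (λ v → h (a ∷ updateAt v i τ))) ≡⟨ ∑-cong xs (λ a →
                                                                    ∑-allVec-updateAt τ τ-invariant k i (h ∘ (a ∷_))) ⟩
    ∑ xs (λ a → ∑ (allVec xs k) (h ∘ (a ∷_)))                   ≡⟨ ∑-allVec-suc k h ⟨
    ∑ (allVec xs (suc k)) h                                      ∎

-- xs lists every element of A exactly once, expressed through sums of point masses.
Enumerates : {A : Set} → DecidableEquality A → List A → Set
Enumerates {A} _≟_ xs = ∀ (g : A → ℤ) b → ∑ xs (λ a → if isYes (a ≟ b) then g a else 0ℤ) ≡ g b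

module _ {A : Set} (_≟_ : DecidableEquality A) where

  isYes-≡-dec-∷ : ∀ {k} a b (v w : Vec A k) →
    isYes (Vec.≡-dec _≟_ (a ∷ v) (b ∷ w)) ≡ isYes (a ≟ b) ∧ isYes (Vec.≡-dec _≟_ v w)
  isYes-≡-dec-∷ a b v w with a ≟ b | Vec.≡-dec _≟_ v w
  ... | yes _ | yes _ = refl
  ... | yes _ | no _  = refl
  ... | no _  | yes _ = refl
  ... | no _  | no _  = refl

  enumerates-allVec : ∀ {xs} → Enumerates _≟_ xs → ∀ k → Enumerates (Vec.≡-dec _≟_) (allVec xs k)
  enumerates-allVec {xs} enum zero    g []      = ℤ.+-identityʳ (g [])
  enumerates-allVec {xs} enum (suc k) g (b ∷ w) = begin
    ∑ (allVec xs (suc k)) (λ v → if isYes (Vec.≡-dec _≟_ v (b ∷ w)) then g v else 0ℤ)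
      ≡⟨ ∑-allVec-suc xs k _ ⟩
    ∑ xs (λ a → ∑ (allVec xs k) (λ v → if isYes (Vec.≡-dec _≟_ (a ∷ v) (b ∷ w)) then g (a ∷ v) else 0ℤ))
      ≡⟨ ∑-cong xs (λ a → ∑-cong (allVec xs k) (λ v →
           cong (λ t → if t then g (a ∷ v) else 0ℤ) (isYes-≡-dec-∷ a b v w))) ⟩
    ∑ xs (λ a → ∑ (allVec xs k) (λ v → if isYes (a ≟ b) ∧ isYes (Vec.≡-dec _≟_ v w) then g (a ∷ v) else 0ℤ))
      ≡⟨ ∑-cong xs first-coordinate ⟩
    ∑ xs (λ a → if isYes (a ≟ b) then g (a ∷ w) else 0ℤ)
      ≡⟨ enum (λ a → g (a ∷ w)) b ⟩
    g (b ∷ w) ∎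
    where
    first-coordinate : ∀ a →
      ∑ (allVec xs k) (λ v → if isYes (a ≟ b) ∧ isYes (Vec.≡-dec _≟_ v w) then g (a ∷ v) else 0ℤ)
        ≡ (if isYes (a ≟ b) then g (a ∷ w) else 0ℤ)
    first-coordinate a with isYes (a ≟ b)
    ... | true  = enumerates-allVec enum k (g ∘ (a ∷_)) w
    ... | false = ∑-zero (allVec xs k)

module _ {n : ℕ} where

  private
    bools : List Bool
    bools = true ∷ false ∷ []

  ∈-allEdgeSets : (E : EdgeSet n) → E ∈ allEdgeSets n
  ∈-allEdgeSets = ∈-allVec (allVec bools n) (∈-allVec bools ∈-bools)
    where
    ∈-bools : ∀ b → b ∈ bools
    ∈-bools true  = here refl
    ∈-bools false = there (here refl)

  ∑-allEdgeSets-δ : ∀ (h : EdgeSet n → ℤ) z → ∑ (allEdgeSets n) (λ w → if w == z then h w else 0ℤ) ≡ h z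
  ∑-allEdgeSets-δ = enumerates-allVec (Vec.≡-dec Bool._≟_) (enumerates-allVec Bool._≟_ enumerates-bools n) n
    where
    enumerates-bools : Enumerates Bool._≟_ bools
    enumerates-bools g true  = ℤ.+-identityʳ (g true)
    enumerates-bools g false = trans (ℤ.+-identityˡ _) (ℤ.+-identityʳ (g false))

  ∑-allEdgeSets-toggle : ∀ a b (h : EdgeSet n → ℤ) → ∑ (allEdgeSets n) (λ w → h (toggle w a b)) ≡ ∑ (allEdgeSets n) h
  ∑-allEdgeSets-toggle a b = ∑-allVec-updateAt (allVec bools n) (λ r → updateAt r b not)
    (∑-allVec-updateAt bools not ∑-bools-not n b) n a
    where
    ∑-bools-not : ∀ g → ∑ bools (g ∘ not) ≡ ∑ bools g
    ∑-bools-not g = trans (sym (ℤ.+-assoc (g false) (g true) 0ℤ))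
      (trans (cong (_+ 0ℤ) (ℤ.+-comm (g false) (g true))) (ℤ.+-assoc (g true) (g false) 0ℤ))

-- Free edges

module _ {n : ℕ} where

  record FreeEdge (x z : EdgeSet n) : Set where
    field
      a b             : Fin n
      ab∈z            : T (edge z a b)
      ab∉x            : ¬ T (edge x a b)
      right-crossings : ∀ c d → Crossing z a c b d → T (edge x c b)
      left-crossings  : ∀ c d → Crossing z c a d b → T (edge x a d)

  free-edge-within : ∀ {x z : EdgeSet n} → B1 z → ∀ {a b} → Acc _<_ (toℕ b ∸ toℕ a) →
    toℕ a < toℕ b → T (edge z a b) → ¬ T (edge x a b) → FreeEdge x z
  free-edge-within {x} {z} b1 {a} {b} (acc shorter) a<b ab∈z ab∉x
    with Fin.any? (λ c → Fin.any? (λ d → crossing? z a c b d ×-dec ¬? (T? (edge x c b))))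
  ... | yes (c , d , cr@(a<c , c<b , _) , cb∉x) =
    free-edge-within b1 (shorter (ℕ.∸-monoʳ-< a<c (ℕ.<⇒≤ c<b))) c<b (b1 a c b d cr) cb∉x
  ... | no no-right
    with Fin.any? (λ c → Fin.any? (λ d → crossing? z c a d b ×-dec ¬? (T? (edge x a d))))
  ... | yes (c , d , cr@(_ , a<d , d<b , _) , ad∉x) =
    free-edge-within b1 (shorter (ℕ.∸-monoˡ-< d<b (ℕ.<⇒≤ a<d))) a<d (b1 c a d b cr) ad∉x
  ... | no no-left = record
    { a = a ; b = b ; ab∈z = ab∈z ; ab∉x = ab∉x
    ; right-crossings = λ c d cr → decidable-stable (T? _) (λ cb∉x → no-right (c , d , cr , cb∉x))
    ; left-crossings  = λ c d cr → decidable-stable (T? _) (λ ad∉x → no-left (c , d , cr , ad∉x))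
    }

  free-edge : ∀ {ε} {x z : EdgeSet n} → IsNetwork ε z → x ⊆ z → x ≢ z → FreeEdge x z
  free-edge {x = x} {z} z-net x⊆z x≢z
    with Fin.any? (λ a → Fin.any? (λ b → T? (edge z a b) ×-dec ¬? (T? (edge x a b))))
  ... | yes (a , b , ab∈z , ab∉x) = free-edge-within (IsNetwork.b1 z-net) (<-wellFounded _)
                                      (proj₁ (IsNetwork.signed z-net a b ab∈z)) ab∈z ab∉x
  ... | no none = ⊥-elim (x≢z (⊆-antisym {x = x} {z} x⊆z z⊆x))
    where
    z⊆x : z ⊆ x
    z⊆x i j ij∈z = decidable-stable (T? _) (λ ij∉x → none (i , j , ij∈z , ij∉x))

  record Admissible (x z w : EdgeSet n) : Set where
    constructor admissible
    field
      lower           : x ⊆ w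
      upper           : w ⊆ z
      no-new-crossing : NoNewCrossing x w

  admissible? : ∀ x z w → Dec (Admissible x z w)
  admissible? x z w = map′ (λ (l , u , nc) → admissible l u nc) (λ (admissible l u nc) → l , u , nc)
    (x ⊆? w ×-dec w ⊆? z ×-dec noNewCrossing? x w)

  admissible⇒network : ∀ {ε} {x z w : EdgeSet n} → IsNetwork ε z → Admissible x z w → IsNetwork ε w
  admissible⇒network {x = x} {z} {w} z-net (admissible x⊆w w⊆z nc) =
    network-⊆ {w = w} {z} z-net w⊆z (noNewCrossing⇒B1 {x = x} {w} x⊆w nc)

  admissible-toggle : ∀ {x z : EdgeSet n} (F : FreeEdge x z) → let open FreeEdge F in
    ∀ w → ¬ T (edge w a b) → Admissible x z w ⇔ Admissible x z (toggle w a b)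
  admissible-toggle {x} {z} F w ab∉w = mk⇔ forth back
    where
    open FreeEdge F
    w′ = toggle w a b
    w⊆w′ = ⊆-toggle w ab∉w

    forth : Admissible x z w → Admissible x z w′
    forth (admissible x⊆w w⊆z nc) = admissible (⊆-trans {x = x} {w} {w′} x⊆w w⊆w′) w′⊆z nc′
      where
      w′⊆z : w′ ⊆ z
      w′⊆z i j e with edge-toggle⁻ w e
      ... | inj₁ (refl , refl) = ab∈z
      ... | inj₂ ij∈w          = w⊆z i j ij∈w
      nc′ : NoNewCrossing x w′
      nc′ i j k l (i<j , j<k , k<l , ik , jl) with edge-toggle⁻ w ik | edge-toggle⁻ w jl
      ... | inj₁ (refl , refl) | _                  = right-crossings j l (i<j , j<k , k<l , ab∈z , w′⊆z j l jl)
      ... | inj₂ _             | inj₁ (refl , refl) = left-crossings i k (i<j , j<k , k<l , w′⊆z i k ik , ab∈z)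
      ... | inj₂ ik∈w          | inj₂ jl∈w          = nc i j k l (i<j , j<k , k<l , ik∈w , jl∈w)

    back : Admissible x z w′ → Admissible x z w
    back (admissible x⊆w′ w′⊆z nc′) =
      admissible x⊆w (⊆-trans {x = w} {w′} {z} w⊆w′ w′⊆z) (noNewCrossing-⊆ {x = x} {w} {w′} w⊆w′ nc′)
      where
      x⊆w : x ⊆ w
      x⊆w i j e with edge-toggle⁻ w (x⊆w′ i j e)
      ... | inj₁ (refl , refl) = ⊥-elim (ab∉x e)
      ... | inj₂ ij∈w          = ij∈w

-- Chains of covers

module _ {n : ℕ} {ε : Fin n → Sign} where

  ≤⇒⊆ : ∀ {x y} → x ≤[ ε ] y → x ⊆ y
  ≤⇒⊆ {x} ε★ = ⊆-refl {x = x}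
  ≤⇒⊆ {x} {y} (_◅_ {j = w} c p) = ⊆-trans {x = x} {w} {y} (IsCover.subset (cover⁻ ε x w c)) (≤⇒⊆ p)

  ≤⇒network : ∀ {x y} → IsNetwork ε x → x ≤[ ε ] y → IsNetwork ε y
  ≤⇒network x-net ε★                 = x-net
  ≤⇒network {x} _  (_◅_ {j = w} c p) = ≤⇒network (IsCover.target (cover⁻ ε x w c)) p

  chainLength : ∀ {x y} → x ≤[ ε ] y → ℕ
  chainLength ε★      = 0
  chainLength (_ ◅ p) = suc (chainLength p)

  ρ-chain : ∀ {x y} (p : x ≤[ ε ] y) → ρ y ≡ chainLength p +ℕ ρ x
  ρ-chain ε★ = refl
  ρ-chain {x} (_◅_ {j = w} c p) = trans (ρ-chain p)
    (trans (cong (chainLength p +ℕ_) (IsCover.ρ-suc (cover⁻ ε x w c))) (ℕ.+-suc (chainLength p) (ρ x)))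

  chainB-chain : ∀ {x y} → IsNetwork ε x → (p : x ≤[ ε ] y) → T (chainB ε (chainLength p) x y)
  chainB-chain {x} x-net ε★ = from (T-∧ {isNetwork ε x}) (network⁺ ε x x-net , fromWitness {a? = x ≟ₑ x} refl)
  chainB-chain {x} x-net (_◅_ {j = w} c p) = any⁺ _ (lose (∈-allEdgeSets w)
    (from (T-∧ {coverB ε x w}) (c , chainB-chain (IsCover.target (cover⁻ ε x w c)) p)))

  ≤⇒leqB : ∀ {x y} → IsNetwork ε x → x ≤[ ε ] y → T (leqB ε x y)
  ≤⇒leqB {x} {y} x-net p = subst (λ k → T (chainB ε k x y)) chainLength≡ (chainB-chain x-net p)
    where
    chainLength≡ : chainLength p ≡ ρ y ∸ ρ x
    chainLength≡ = trans (sym (ℕ.m+n∸n≡m (chainLength p) (ρ x))) (cong (_∸ ρ x) (sym (ρ-chain p)))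

  chainB⇒≤ : ∀ k {x y} → T (chainB ε k x y) → x ≤[ ε ] y
  chainB⇒≤ zero {x} {y} h with to (T-∧ {isNetwork ε x}) h
  ... | _ , x≡y = subst (x ≤[ ε ]_) (toWitness {a? = x ≟ₑ y} x≡y) ε★
  chainB⇒≤ (suc k) {x} h with satisfied (any⁻ _ (allEdgeSets n) h)
  ... | w , c∧p with to (T-∧ {coverB ε x w}) c∧p
  ... | c , p = c ◅ chainB⇒≤ k p

  leqB⇒≤ : ∀ {x y} → T (leqB ε x y) → x ≤[ ε ] y
  leqB⇒≤ {x} {y} = chainB⇒≤ (ρ y ∸ ρ x)

  ρ-strict : ∀ {x y} → x ≤[ ε ] y → x ≢ y → ρ x < ρ y
  ρ-strict ε★ x≢x = ⊥-elim (x≢x refl)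
  ρ-strict {x} {y} (_◅_ {j = w} c p) _ = ℕ.<-≤-trans ρx<ρw (ρ-mono w y (≤⇒⊆ p))
    where
    ρx<ρw : ρ x < ρ w
    ρx<ρw = subst (ρ x <_) (sym (IsCover.ρ-suc (cover⁻ ε x w c))) (ℕ.n<1+n (ρ x))

  ⊆⇒≤ : ∀ {x z} → IsNetwork ε x → IsNetwork ε z → x ⊆ z → x ≤[ ε ] z
  ⊆⇒≤ {x} {z} x-net z-net = go (<-wellFounded (ρ z ∸ ρ x)) x-net
    where
    go : ∀ {x} → Acc _<_ (ρ z ∸ ρ x) → IsNetwork ε x → x ⊆ z → x ≤[ ε ] z
    go {x} (acc smaller) x-net x⊆z with x ≟ₑ z
    ... | yes refl = ε★
    ... | no x≢z   = cover⁺ ε x x′ (cover x-net x′-net ρx′≡ (⊆-toggle x ab∉x)) ◅ go (smaller shrinks) x′-net x′⊆z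
      where
      F = free-edge {x = x} z-net x⊆z x≢z
      open FreeEdge F
      x′ = toggle x a b
      admissible-x′ : Admissible x z x′
      admissible-x′ = to (admissible-toggle F x ab∉x) (admissible (⊆-refl {x = x}) x⊆z (IsNetwork.b1 x-net))
      x′-net = admissible⇒network z-net admissible-x′
      x′⊆z = Admissible.upper admissible-x′
      ρx′≡ : ρ x′ ≡ suc (ρ x)
      ρx′≡ = ρ-toggle x a b ab∉x
      shrinks : ρ z ∸ ρ x′ < ρ z ∸ ρ x
      shrinks = ℕ.∸-monoʳ-< (subst (ρ x <_) (sym ρx′≡) (ℕ.n<1+n (ρ x))) (ρ-mono x′ z x′⊆z)

-- The Möbius function

i≡-i⇒i≡0 : ∀ {i} → i ≡ - i → i ≡ 0ℤ
i≡-i⇒i≡0 {ℤ.pos zero} _ = refl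

module Möbius {n : ℕ} (ε : Fin n → Sign) {x : EdgeSet n} (x-net : IsNetwork ε x) where

  sign : EdgeSet n → ℤ
  sign w = (- 1ℤ) ^ (ρ w ∸ ρ x)

  μ-formula : EdgeSet n → ℤ
  μ-formula w = if does (noNewCrossing? x w) then sign w else 0ℤ

  μ-formula-yes : ∀ w → NoNewCrossing x w → μ-formula w ≡ sign w
  μ-formula-yes w nc rewrite dec-true (noNewCrossing? x w) nc = refl

  μ-formula-no : ∀ w → ¬ NoNewCrossing x w → μ-formula w ≡ 0ℤ
  μ-formula-no w ¬nc rewrite dec-false (noNewCrossing? x w) ¬nc = refl

  μ-formula-self : μ-formula x ≡ 1ℤ
  μ-formula-self = trans (μ-formula-yes x (IsNetwork.b1 x-net)) (cong ((- 1ℤ) ^_) (ℕ.n∸n≡0 (ρ x)))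

  sign-toggle : ∀ w a b → x ⊆ w → ¬ T (edge w a b) → sign (toggle w a b) ≡ - sign w
  sign-toggle w a b x⊆w ab∉w = begin
    (- 1ℤ) ^ (ρ (toggle w a b) ∸ ρ x) ≡⟨ cong (λ m → (- 1ℤ) ^ (m ∸ ρ x)) (ρ-toggle w a b ab∉w) ⟩
    (- 1ℤ) ^ (suc (ρ w) ∸ ρ x)        ≡⟨ cong ((- 1ℤ) ^_) (ℕ.+-∸-assoc 1 (ρ-mono x w x⊆w)) ⟩
    (- 1ℤ) ^ suc (ρ w ∸ ρ x)          ≡⟨ ℤ.-1*i≡-i (sign w) ⟩
    - sign w                          ∎

  module Interval {z : EdgeSet n} (z-net : IsNetwork ε z) where

    weight : EdgeSet n → ℤ
    weight w = if does (admissible? x z w) then sign w else 0ℤ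

    weight-yes : ∀ w → Admissible x z w → weight w ≡ sign w
    weight-yes w adm rewrite dec-true (admissible? x z w) adm = refl

    weight-no : ∀ w → ¬ Admissible x z w → weight w ≡ 0ℤ
    weight-no w ¬adm rewrite dec-false (admissible? x z w) ¬adm = refl

    weight≡μ-formula : ∀ w → x ⊆ w → w ⊆ z → weight w ≡ μ-formula w
    weight≡μ-formula w x⊆w w⊆z = case noNewCrossing? x w of λ where
      (yes nc) → trans (weight-yes w (admissible x⊆w w⊆z nc)) (sym (μ-formula-yes w nc))
      (no ¬nc) → trans (weight-no w (¬nc ∘ Admissible.no-new-crossing)) (sym (μ-formula-no w ¬nc))

    module _ (F : FreeEdge x z) where
      open FreeEdge F

      weight-add : ∀ w → ¬ T (edge w a b) → weight (toggle w a b) ≡ - weight w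
      weight-add w ab∉w = case admissible? x z w of λ where
        (yes adm) → begin
          weight (toggle w a b) ≡⟨ weight-yes (toggle w a b) (to (admissible-toggle F w ab∉w) adm) ⟩
          sign (toggle w a b)   ≡⟨ sign-toggle w a b (Admissible.lower adm) ab∉w ⟩
          - sign w              ≡⟨ cong -_ (weight-yes w adm) ⟨
          - weight w            ∎
        (no ¬adm) → trans (weight-no (toggle w a b) (¬adm ∘ from (admissible-toggle F w ab∉w)))
                          (cong -_ (sym (weight-no w ¬adm)))

      weight-toggle : ∀ w → weight (toggle w a b) ≡ - weight w
      weight-toggle w = case T? (edge w a b) of λ where
        (no ab∉w)  → weight-add w ab∉w
        (yes ab∈w) → begin
          weight (toggle w a b)                ≡⟨ ℤ.neg-involutive _ ⟨
          - - weight (toggle w a b)            ≡⟨ cong -_ (weight-add (toggle w a b) (toggle-removes w ab∈w)) ⟨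
          - weight (toggle (toggle w a b) a b) ≡⟨ cong (-_ ∘ weight) (toggle-involutive w a b) ⟩
          - weight w                           ∎

    ∑-weight≡0 : x ⊆ z → x ≢ z → ∑ (allEdgeSets n) weight ≡ 0ℤ
    ∑-weight≡0 x⊆z x≢z = i≡-i⇒i≡0 (begin
      ∑ (allEdgeSets n) weight                        ≡⟨ ∑-allEdgeSets-toggle a b weight ⟨
      ∑ (allEdgeSets n) (λ w → weight (toggle w a b)) ≡⟨ ∑-cong (allEdgeSets n) (weight-toggle F) ⟩
      ∑ (allEdgeSets n) (λ w → - weight w)            ≡⟨ ∑-neg (allEdgeSets n) weight ⟩
      - ∑ (allEdgeSets n) weight                      ∎)
      where
      F = free-edge {x = x} z-net x⊆z x≢z
      open FreeEdge F

    -- The filter predicate in the recursion defining μF ε (suc k) x z.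
    below : EdgeSet n → Bool
    below w = leqB ε x w ∧ leqB ε w z ∧ not (w == z)

    below⁻ : ∀ {w} → T (below w) → x ≤[ ε ] w × w ≤[ ε ] z × w ≢ z
    below⁻ {w} h with to (T-∧ {leqB ε x w}) h
    ... | x≤w , h′ with to (T-∧ {leqB ε w z}) h′
    ... | w≤z , w≢z = leqB⇒≤ x≤w , leqB⇒≤ w≤z , toWitnessFalse w≢z

    below⁺ : ∀ {w} → x ≤[ ε ] w → w ≤[ ε ] z → w ≢ z → T (below w)
    below⁺ {w} x≤w w≤z w≢z = from (T-∧ {leqB ε x w}) (≤⇒leqB x-net x≤w ,
      from (T-∧ {leqB ε w z}) (≤⇒leqB (≤⇒network x-net x≤w) w≤z , fromWitnessFalse w≢z))

    below-≡ : ∀ {w} → w ≡ z → below w ≡ false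
    below-≡ {w} w≡z = begin
      leqB ε x w ∧ leqB ε w z ∧ not (w == z) ≡⟨ cong (λ c → leqB ε x w ∧ leqB ε w z ∧ not c) (==-true w≡z) ⟩
      leqB ε x w ∧ leqB ε w z ∧ false        ≡⟨ cong (leqB ε x w ∧_) (∧-zeroʳ (leqB ε w z)) ⟩
      leqB ε x w ∧ false                     ≡⟨ ∧-zeroʳ (leqB ε x w) ⟩
      false                                  ∎

    μ-below : EdgeSet n → ℤ
    μ-below w = if below w then μ-formula w else 0ℤ

    μ-below≡weight : ∀ {w} → w ≢ z → μ-below w ≡ weight w
    μ-below≡weight {w} w≢z with below w in eq
    ... | true  = let x≤w , w≤z , _ = below⁻ (subst T (sym eq) _) in
                  sym (weight≡μ-formula w (≤⇒⊆ {ε = ε} x≤w) (≤⇒⊆ {ε = ε} w≤z))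
    ... | false = sym (weight-no w λ adm → subst T eq (below⁺ (x≤w adm) (w≤z adm) w≢z))
      where
      x≤w : Admissible x z w → x ≤[ ε ] w
      x≤w adm = ⊆⇒≤ x-net (admissible⇒network z-net adm) (Admissible.lower adm)
      w≤z : Admissible x z w → w ≤[ ε ] z
      w≤z adm = ⊆⇒≤ (admissible⇒network z-net adm) z-net (Admissible.upper adm)

    μ-below+δ≡weight : ∀ w → μ-below w + (if w == z then weight w else 0ℤ) ≡ weight w
    μ-below+δ≡weight w = case w ≟ₑ z of λ where
      (yes w≡z) → trans (cong₂ (λ b c → (if b then μ-formula w else 0ℤ) + (if c then weight w else 0ℤ))
                               (below-≡ w≡z) (==-true w≡z))
                        (ℤ.+-identityˡ (weight w))
      (no w≢z) → trans (cong (μ-below w +_) (cong (if_then weight w else 0ℤ) (==-false w≢z)))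
                       (trans (ℤ.+-identityʳ _) (μ-below≡weight w≢z))

    ∑-μ-below : x ≤[ ε ] z → x ≢ z → ∑ (allEdgeSets n) μ-below ≡ - μ-formula z
    ∑-μ-below x≤z x≢z = inverseˡ-unique _ (μ-formula z) (begin
      ∑ (allEdgeSets n) μ-below + μ-formula z
        ≡⟨ cong (∑ (allEdgeSets n) μ-below +_)
                (trans (∑-allEdgeSets-δ weight z) (weight≡μ-formula z x⊆z (⊆-refl {x = z}))) ⟨
      ∑ (allEdgeSets n) μ-below + ∑ (allEdgeSets n) (λ w → if w == z then weight w else 0ℤ)
        ≡⟨ ∑-+ (allEdgeSets n) μ-below _ ⟨
      ∑ (allEdgeSets n) (λ w → μ-below w + (if w == z then weight w else 0ℤ))
        ≡⟨ ∑-cong (allEdgeSets n) μ-below+δ≡weight ⟩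
      ∑ (allEdgeSets n) weight
        ≡⟨ ∑-weight≡0 x⊆z x≢z ⟩
      0ℤ ∎)
      where
      x⊆z = ≤⇒⊆ {ε = ε} x≤z

  μF≡μ-formula : ∀ k {z} → x ≤[ ε ] z → ρ z ∸ ρ x < k → μF ε k x z ≡ μ-formula z
  μF≡μ-formula (suc k) {z} x≤z bound with x ≟ₑ z
  ... | yes refl = sym μ-formula-self
  ... | no x≢z = begin
      - ∑ (filter (λ w → T? (below w)) (allEdgeSets n)) (μF ε k x)
        ≡⟨ cong -_ (∑-filter (allEdgeSets n) below (μF ε k x)) ⟩
      - ∑ (allEdgeSets n) (λ w → if below w then μF ε k x w else 0ℤ)
        ≡⟨ cong -_ (∑-cong (allEdgeSets n) induction-hypothesis) ⟩
      - ∑ (allEdgeSets n) μ-below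
        ≡⟨ cong -_ (∑-μ-below x≤z x≢z) ⟩
      - - μ-formula z
        ≡⟨ ℤ.neg-involutive (μ-formula z) ⟩
      μ-formula z ∎
    where
    open Interval (≤⇒network x-net x≤z)
    induction-hypothesis : ∀ w → (if below w then μF ε k x w else 0ℤ) ≡ μ-below w
    induction-hypothesis w with below w in eq
    ... | false = refl
    ... | true with below⁻ (subst T (sym eq) _)
    ...   | x≤w , w≤z , w≢z = μF≡μ-formula k x≤w (ℕ.<-≤-trans ρw∸ρx<ρz∸ρx (ℕ.≤-pred bound))
      where
      ρw∸ρx<ρz∸ρx : ρ w ∸ ρ x < ρ z ∸ ρ x
      ρw∸ρx<ρz∸ρx = ℕ.∸-monoˡ-< (ρ-strict {ε = ε} w≤z w≢z) (ρ-mono x w (≤⇒⊆ {ε = ε} x≤w))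

theorem5p14 : (n : ℕ) (ε : Fin n → Sign) → FirstNonzeroPlus ε →
    (x y : EdgeSet n) → Network ε x → Network ε y → x ≤[ ε ] y →
    (CrossingNonempty x y → μ ε x y ≡ 0ℤ) ×
    (¬ CrossingNonempty x y → μ ε x y ≡ (- 1ℤ) ^ (ρ y ∸ ρ x))
theorem5p14 n ε _ x y x-net _ x≤y = μ-on-crossing , μ-on-no-crossing
  where
  open Möbius ε (network⁻ ε x x-net)
  μ≡μ-formula : μ ε x y ≡ μ-formula y
  μ≡μ-formula = μF≡μ-formula (suc (ρ y ∸ ρ x)) x≤y (ℕ.n<1+n _)
  μ-on-crossing : CrossingNonempty x y → μ ε x y ≡ 0ℤ
  μ-on-crossing c = trans μ≡μ-formula (μ-formula-no y (crossingNonempty⇒¬noNewCrossing x y c))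
  μ-on-no-crossing : ¬ CrossingNonempty x y → μ ε x y ≡ (- 1ℤ) ^ (ρ y ∸ ρ x)
  μ-on-no-crossing ¬c = trans μ≡μ-formula (μ-formula-yes y (¬crossingNonempty⇒noNewCrossing x y ¬c))
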